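{- Let $N \geq 1$ be an integer and $r \in \mathbb{C}$. Then, in $\mathbb{C}\{[\ell]\}[[y]]$, \[ e^{y\frac{d}{dx}}\big(\ell_{ -N}(x)^{r}\big)=\sum_{m \geq 0}\frac{y^{m}}{m!}\sum_{\substack{j_{1}+\cdots+j_{N}=m\\ j_1,\dots,j_N\ge0}} r^{j_{N}}\left(\prod_{i=1}^{N-1}\begin{Bmatrix}\alpha_{i}\\ \alpha_{i+1}\end{Bmatrix}\right)\ell_{ -N}(x)^{r}\prod_{i=1}^{N-1}\ell_{ -i}(x)^{\alpha_{i+1}}, \] where $\alpha_{i}=j_{i}+j_{i+1}+\cdots+j_{N}$ and $r^0=1$. (The left side is denoted $\ell_{ -N}(x+y)^r$ in the paper.)
   Context: Let $\ell_{n}(x)$, $n \in \mathbb{Z}$, be commuting formal variables and let $\mathbb{C}\{[\ell]\}$ be the commutative algebra with vector space basis all monomials $\prod_{i \in \mathbb{Z}}\ell_{i}(x)^{r_{i}}$ with $r_i\in\mathbb{C}$ and all but finitely many $r_i=0$, multiplication given by adding exponents. Let $\frac{d}{dx}$ be the unique derivation of $\mathbb{C}\{[\ell]\}$ with $\frac{d}{dx}\ell_{0}(x)^{r}=r\ell_{0}(x)^{r-1}$, and for $n>0$, $r\in\mathbb{C}$: $\frac{d}{dx}\ell_{n}(x)^{r}=r\ell_{n}(x)^{r-1}\prod_{i=0}^{n-1}\ell_{i}(x)^{ -1}$ and $\frac{d}{dx}\ell_{ -n}(x)^{r}=r\ell_{ -n}(x)^{r-1}\prod_{i=1}^{n}\ell_{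 -i}(x)$. For a formal variable $y$, $e^{y\frac{d}{dx}}=\sum_{k\ge0}\frac{y^k}{k!}\left(\frac{d}{dx}\right)^k$. The Stirling numbers of the second kind are $\begin{Bmatrix}m\\ n\end{Bmatrix}=\sum_{0 \leq i_{1} \leq i_{2} \leq \cdots \leq i_{m-n} \leq n}i_{1}i_{2}\cdots i_{m-n}$ for $0\le n\le m$ (empty product $=1$), with $\begin{Bmatrix}0\\0\end{Bmatrix}=1$ and $\begin{Bmatrix}m\\0\end{Bmatrix}=0$ for $m\ge1$. -}

module Defs where

open import Level using (_⊔_)
open import Algebra.Bundles using (CommutativeRing)
open import Data.Nat as ℕ using (ℕ; zero; suc; _∸_; _≤ᵇ_)
open import Data.Integer as ℤ using (ℤ; +_; -[1+_])
open import Data.Bool using (if_then_else_)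
open import Data.Product using (_×_; _,_)
open import Data.List using (List; []; _∷_; map; concatMap; upTo; drop; _++_)
import Data.List as L
import Data.Nat.ListAction as NL
open import Relation.Nullary.Decidable using (does)

-- Stirling numbers of the second kind, exactly as in the paper:
--   S(m,n) = sum over 0 ≤ i₁ ≤ … ≤ i_{m-n} ≤ n of i₁ ⋯ i_{m-n}.
-- hsum k n = sum over nondecreasing sequences 0 ≤ i₁ ≤ … ≤ i_k ≤ n of the
-- product i₁⋯i_k  (split on the value t of the last entry i_k).
hsum : ℕ → ℕ → ℕ
hsum zero    n = 1
hsum (suc k) n = NL.sum (map (λ t → t ℕ.* hsum k t) (upTo (suc n)))

stirling : ℕ → ℕ → ℕ
stirling m n = if n ≤ᵇ m then hsum (m ∸ n) n else 0

compositions : ℕ → ℕ → List (List ℕ)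
compositions zero    zero    = [] ∷ []
compositions zero    (suc m) = []
compositions (suc N) m =
  concatMap (λ j → map (j ∷_) (compositions N (m ∸ j))) (upTo (suc m))

-- The algebra K{[ℓ]} (the paper takes K = ℂ) and the derivation d/dx.
module Alg {c ℓ} (K : CommutativeRing c ℓ) where
  open CommutativeRing K

  ℕ→K : ℕ → Carrier
  ℕ→K zero    = 0#
  ℕ→K (suc n) = 1# + ℕ→K n

  pow : Carrier → ℕ → Carrier
  pow x zero    = 1#
  pow x (suc n) = x * pow x n

  -- A monomial ∏ ℓ_i(x)^{r_i} represented by a finite list of factors
  -- (i , r) meaning ℓ_i(x)^r.
  Mono : Set c
  Mono = List (ℤ × Carrier)

  expo : Mono → ℤ → Carrier
  expo []            i = 0#
  expo ((j , r) ∷ M) i = if does (j ℤ.≟ i) then r + expo M i else expo M i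

  _≈ₘ_ : Mono → Mono → Set ℓ
  M ≈ₘ M' = ∀ i → expo M i ≈ expo M' i

  -- An element of K{[ℓ]}: a finite formal K-linear combination of monomials
  Elem : Set c
  Elem = List (Carrier × Mono)

  -- Equality in K{[ℓ]}: the free K-module on the monomials, presented as
  -- formal sums modulo commutativity, merging of like terms and zero terms.
  infix 4 _≈ₑ_
  data _≈ₑ_ : Elem → Elem → Set (c ⊔ ℓ) where
    ≈ₑ-refl  : ∀ {f} → f ≈ₑ f
    ≈ₑ-sym   : ∀ {f g} → f ≈ₑ g → g ≈ₑ f
    ≈ₑ-trans : ∀ {f g h} → f ≈ₑ g → g ≈ₑ h → f ≈ₑ h
    ≈ₑ-cons  : ∀ {a b M M' f g} → a ≈ b → M ≈ₘ M' → f ≈ₑ g →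
               ((a , M) ∷ f) ≈ₑ ((b , M') ∷ g)
    ≈ₑ-swap  : ∀ {x y f} → (x ∷ y ∷ f) ≈ₑ (y ∷ x ∷ f)
    ≈ₑ-merge : ∀ {a b M f} → ((a , M) ∷ (b , M) ∷ f) ≈ₑ ((a + b , M) ∷ f)
    ≈ₑ-zero  : ∀ {M f} → ((0# , M) ∷ f) ≈ₑ f

  scale : Carrier → Elem → Elem
  scale a = map (λ { (b , M) → (a * b , M) })

  -- d/dx ℓ_i^r = r · (dpart i r), where dpart i r is the monomial
  --   i = 0   : ℓ_0^{r-1}
  --   i = n>0 : ℓ_n^{r-1} ∏_{k=0}^{n-1} ℓ_k^{-1}
  --   i = -n<0: ℓ_{-n}^{r-1} ∏_{k=1}^{n} ℓ_{-k}
  dpart : ℤ → Carrier → Mono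
  dpart (+ zero)    r = (+ 0 , r - 1#) ∷ []
  dpart (+ suc n)   r = (+ suc n , r - 1#) ∷ map (λ k → (+ k , - 1#)) (upTo (suc n))
  dpart (-[1+ n ])  r = (-[1+ n ] , r - 1#) ∷ map (λ k → (-[1+ k ] , 1#)) (upTo (suc n))

  Dmono : Mono → Elem
  Dmono []            = []
  Dmono ((i , r) ∷ M) =
    (r , dpart i r ++ M) ∷ map (λ { (a , M') → (a , (i , r) ∷ M') }) (Dmono M)

  D : Elem → Elem
  D = concatMap (λ { (a , M) → scale a (Dmono M) })

  Diter : ℕ → Elem → Elem
  Diter zero    f = f
  Diter (suc k) f = D (Diter k f)

  -- formal power series in y with coefficients in K{[ℓ]}
  PS : Set c
  PS = ℕ → Elem

  infix 4 _≈ₚ_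
  _≈ₚ_ : PS → PS → Set (c ⊔ ℓ)
  F ≈ₚ G = ∀ m → F m ≈ₑ G m

  -- K is assumed to be a ℚ-algebra: inv n is an inverse of (n+1).
  module Exp (inv : ℕ → Carrier) where
    invFact : ℕ → Carrier
    invFact zero    = 1#
    invFact (suc m) = inv m * invFact m

    -- e^{y d/dx} f = Σ_k y^k/k! (d/dx)^k f ; coefficient of y^m
    expYD : Elem → PS
    expYD f m = scale (invFact m) (Diter m f)

    ellNeg : ℕ → Carrier → Elem
    ellNeg N r = (1# , (ℤ.- (+ N) , r) ∷ []) ∷ []

    -- For js = [j₁,…,j_N]: α i = j_i + … + j_N  (1-indexed)
    α : List ℕ → ℕ → ℕ
    α js i = NL.sum (drop (i ∸ 1) js)

    term : ℕ → Carrier → List ℕ → Carrier × Mono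
    term N r js =
      ( pow r (α js N) * ℕ→K (NL.product (map (λ i → stirling (α js i) (α js (suc i)))
                                              (map suc (upTo (N ∸ 1)))))
      , (ℤ.- (+ N) , r) ∷ map (λ i → (ℤ.- (+ i) , ℕ→K (α js (suc i))))
                                (map suc (upTo (N ∸ 1))) )

    rhs : ℕ → Carrier → PS
    rhs N r m = scale (invFact m) (map (term N r) (compositions N m))

-- Read ℓ₋₁ as eˣ and ℓ₋₍ᵢ₊₁₎ as e^{ℓ₋ᵢ}. Renaming every ℓ₋ᵢ to ℓ₋₍ᵢ₊₁₎ (the shift σ) is
-- then the substitution x ↦ eˣ, and on elements built from negative indices only the
-- derivation satisfies D (σ f) = ℓ₋₁ · σ (D f). The classical identity
-- (d/dx)ᵐ f(eˣ) = Σₐ S(m,a) e^{ax} f⁽ᵃ⁾(eˣ), proved by induction on m from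
-- S(m+1,a+1) = (a+1) S(m,a+1) + S(m,a), therefore becomes
--   Dᵐ (σ F) = Σₐ S(m,a) ℓ₋₁ᵃ σ (Dᵃ F).
-- Taking F = ℓ₋ₙʳ, induction on N starting from Dᵐ ℓ₋₁ʳ = rᵐ ℓ₋₁ʳ yields the sum over
-- compositions: j₁ = m − a, and (j₂,…,j_{N+1}) runs over the compositions of a = α₂.
module Submission where

open import Algebra.Bundles using (CommutativeRing)
open import Level using (_⊔_)
open import Data.Bool using (true; false; if_then_else_)
open import Data.Empty using (⊥; ⊥-elim)
open import Data.Integer as ℤ using (ℤ; +_; -[1+_])
open import Data.List as L using (List; []; _∷_; [_]; _++_; map; concat; concatMap; upTo; applyUpTo)
import Data.List.Properties as LP
open import Data.List.Membership.Propositional using (_∈_)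
import Data.List.Membership.Propositional.Properties as ∈P
open import Data.List.Relation.Unary.All as All using (All; []; _∷_)
import Data.List.Relation.Unary.All.Properties as AllP
open import Data.List.Relation.Unary.AllPairs using ([]; _∷_)
open import Data.List.Relation.Unary.Any using (here; there)
open import Data.List.Relation.Unary.Unique.Propositional using (Unique)
import Data.List.Relation.Unary.Unique.DecPropositional.Properties as UniqueP
open import Data.Nat as ℕ using (ℕ; zero; suc; _≤_; _<_; _∸_; _≤ᵇ_; s≤s; z≤n)
import Data.Nat.ListAction as NL
import Data.Nat.ListAction.Properties as NLP
import Data.Nat.Properties as ℕP
open import Data.Product using (_×_; _,_; proj₁; proj₂)
open import Data.Unit using (⊤; tt)
open import Function using (_∘_)
open import Relation.Binary using (Setoid; tri<; tri≈; tri>)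
import Relation.Binary.Reasoning.Setoid as SetoidReasoning
open import Relation.Binary.PropositionalEquality as ≡ using (_≡_; refl; cong; cong₂)
open import Relation.Nullary using (¬_; yes; no)
open import Relation.Nullary.Decidable using (does; dec-true; dec-false)

open import Defs

stirling-unfold : ∀ {m n} → n ≤ m → stirling m n ≡ hsum (m ∸ n) n
stirling-unfold {m} {n} n≤m with n ≤ᵇ m | ℕP.≤⇒≤ᵇ n≤m
... | true  | _  = refl
... | false | ()

stirling-vanish : ∀ {m n} → m < n → stirling m n ≡ 0
stirling-vanish {m} {n} m<n with n ≤ᵇ m | ℕP.≤ᵇ⇒≤ n m
... | false | _    = refl
... | true  | n≤m = ⊥-elim (ℕP.<⇒≱ m<n (n≤m tt))

stirling-diag : ∀ n → stirling n n ≡ 1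
stirling-diag n = ≡.trans (stirling-unfold {n} ℕP.≤-refl) (cong (λ k → hsum k n) (ℕP.n∸n≡0 n))

hsum-suc-suc : ∀ k a → hsum (suc k) (suc a) ≡ hsum (suc k) a ℕ.+ suc a ℕ.* hsum k (suc a)
hsum-suc-suc k a = begin
  NL.sum (map f (upTo (suc (suc a))))                ≡⟨ cong (NL.sum ∘ map f) (LP.upTo-∷ʳ (suc a)) ⟨
  NL.sum (map f (upTo (suc a) ++ [ suc a ]))         ≡⟨ cong NL.sum (LP.map-++ f (upTo (suc a)) [ suc a ]) ⟩
  NL.sum (map f (upTo (suc a)) ++ [ f (suc a) ])     ≡⟨ NLP.sum-++ (map f (upTo (suc a))) [ f (suc a) ] ⟩
  hsum (suc k) a ℕ.+ (f (suc a) ℕ.+ 0)               ≡⟨ cong (hsum (suc k) a ℕ.+_) (ℕP.+-identityʳ _) ⟩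
  hsum (suc k) a ℕ.+ suc a ℕ.* hsum k (suc a)        ∎
  where
  open ≡.≡-Reasoning
  f : ℕ → ℕ
  f t = t ℕ.* hsum k t

stirling-rec : ∀ m a → stirling (suc m) (suc a) ≡ suc a ℕ.* stirling m (suc a) ℕ.+ stirling m a
stirling-rec m a with ℕP.<-cmp a m
... | tri< a<m _ _ = begin
  stirling (suc m) (suc a)                     ≡⟨ stirling-unfold (s≤s (ℕP.<⇒≤ a<m)) ⟩
  hsum (m ∸ a) (suc a)                         ≡⟨ cong (λ i → hsum i (suc a)) m∸a≡1+k ⟩
  hsum (suc k) (suc a)                         ≡⟨ hsum-suc-suc k a ⟩
  hsum (suc k) a ℕ.+ suc a ℕ.* hsum k (suc a)  ≡⟨ ℕP.+-comm (hsum (suc k) a) _ ⟩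
  suc a ℕ.* hsum k (suc a) ℕ.+ hsum (suc k) a  ≡⟨ cong₂ (λ x y → suc a ℕ.* x ℕ.+ y) (stirling-unfold a<m) S[m,a] ⟨
  suc a ℕ.* stirling m (suc a) ℕ.+ stirling m a ∎
  where
  open ≡.≡-Reasoning
  k = m ∸ suc a
  m∸a≡1+k : m ∸ a ≡ suc k
  m∸a≡1+k = ℕP.+-∸-assoc 1 a<m
  S[m,a] : stirling m a ≡ hsum (suc k) a
  S[m,a] = ≡.trans (stirling-unfold (ℕP.<⇒≤ a<m)) (cong (λ i → hsum i a) m∸a≡1+k)
... | tri≈ _ refl _ = begin
  stirling (suc a) (suc a)                     ≡⟨ stirling-diag (suc a) ⟩
  1                                            ≡⟨ cong (ℕ._+ 1) (ℕP.*-zeroʳ (suc a)) ⟨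
  suc a ℕ.* 0 ℕ.+ 1                            ≡⟨ cong₂ (λ x y → suc a ℕ.* x ℕ.+ y) S[a,1+a] (stirling-diag a) ⟨
  suc a ℕ.* stirling a (suc a) ℕ.+ stirling a a ∎
  where
  open ≡.≡-Reasoning
  S[a,1+a] : stirling a (suc a) ≡ 0
  S[a,1+a] = stirling-vanish {a} ℕP.≤-refl
... | tri> _ _ m<a = begin
  stirling (suc m) (suc a)                     ≡⟨ stirling-vanish (s≤s m<a) ⟩
  0                                            ≡⟨ cong (ℕ._+ 0) (ℕP.*-zeroʳ (suc a)) ⟨
  suc a ℕ.* 0 ℕ.+ 0                            ≡⟨ cong₂ (λ x y → suc a ℕ.* x ℕ.+ y) S[m,1+a] (stirling-vanish m<a) ⟨
  suc a ℕ.* stirling m (suc a) ℕ.+ stirling m a ∎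
  where
  open ≡.≡-Reasoning
  S[m,1+a] : stirling m (suc a) ≡ 0
  S[m,1+a] = stirling-vanish (ℕP.m<n⇒m<1+n m<a)

compositions-1 : ∀ m → compositions 1 m ≡ [ m ∷ [] ]
compositions-1 m = begin
  concatMap f (upTo (suc m))                 ≡⟨ cong (concatMap f) (LP.upTo-∷ʳ m) ⟨
  concatMap f (upTo m ++ [ m ])              ≡⟨ LP.concatMap-++ f (upTo m) [ m ] ⟩
  concatMap f (upTo m) ++ concatMap f [ m ]  ≡⟨ cong₂ _++_ (none (upTo m) (AllP.all-upTo m)) last ⟩
  [ m ∷ [] ]                                 ∎
  where
  open ≡.≡-Reasoning
  f : ℕ → List (List ℕ)
  f j = map (j ∷_) (compositions 0 (m ∸ j))
  last : concatMap f [ m ] ≡ [ m ∷ [] ]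
  last = cong (λ k → map (m ∷_) (compositions 0 k) ++ []) (ℕP.n∸n≡0 m)
  none : ∀ js → All (_< m) js → concatMap f js ≡ []
  none []       []         = refl
  none (j ∷ js) (j<m ∷ js<m) =
    ≡.trans (cong (λ k → map (j ∷_) (compositions 0 k) ++ concatMap f js) (ℕP.+-∸-assoc 1 j<m))
            (none js js<m)

compositions-sum : ∀ N m → All (λ js → NL.sum js ≡ m) (compositions N m)
compositions-sum zero    zero    = refl ∷ []
compositions-sum zero    (suc m) = []
compositions-sum (suc N) m = AllP.concat⁺ (AllP.map⁺ (All.map sum-j∷js (AllP.all-upTo (suc m))))
  where
  sum-j∷js : ∀ {j} → j < suc m → All (λ js → NL.sum js ≡ m) (map (j ∷_) (compositions N (m ∸ j)))
  sum-j∷js {j} j<1+m = AllP.map⁺ (All.map (λ eq → ≡.trans (cong (j ℕ.+_) eq) j+[m∸j]≡m)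
                                           (compositions-sum N (m ∸ j)))
    where
    j+[m∸j]≡m : j ℕ.+ (m ∸ j) ≡ m
    j+[m∸j]≡m = ℕP.m+[n∸m]≡n (ℕP.≤-pred j<1+m)

map-suc-upTo : ∀ {a} {A : Set a} (g : ℕ → A) n → map g (map suc (upTo n)) ≡ applyUpTo (g ∘ suc) n
map-suc-upTo g n = ≡.trans (cong (map g) (LP.map-upTo suc n)) (LP.map-applyUpTo suc g n)

map-suc-applyUpTo-suc : ∀ {a} {A : Set a} (g : ℕ → A) n →
  map g (map suc (applyUpTo suc n)) ≡ applyUpTo (g ∘ suc ∘ suc) n
map-suc-applyUpTo-suc g n =
  ≡.trans (cong (map g) (LP.map-applyUpTo suc suc n)) (LP.map-applyUpTo (suc ∘ suc) g n)

module _ {c ℓ} (K : CommutativeRing c ℓ) where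
  open CommutativeRing K renaming (refl to ≈-refl; sym to ≈-sym; trans to ≈-trans)
  open Alg K

  ≡⇒≈ : ∀ {x y} → x ≡ y → x ≈ y
  ≡⇒≈ refl = ≈-refl

  ℕ→K-+ : ∀ a b → ℕ→K (a ℕ.+ b) ≈ ℕ→K a + ℕ→K b
  ℕ→K-+ zero    b = ≈-sym (+-identityˡ _)
  ℕ→K-+ (suc a) b = ≈-trans (+-congˡ (ℕ→K-+ a b)) (≈-sym (+-assoc _ _ _))

  ℕ→K-* : ∀ a b → ℕ→K (a ℕ.* b) ≈ ℕ→K a * ℕ→K b
  ℕ→K-* zero    b = ≈-sym (zeroˡ _)
  ℕ→K-* (suc a) b = ≈-trans (ℕ→K-+ b (a ℕ.* b))
    (≈-trans (+-cong (≈-sym (*-identityˡ _)) (ℕ→K-* a b)) (≈-sym (distribʳ _ _ _)))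

  ℕ→K-1 : ℕ→K 1 ≈ 1#
  ℕ→K-1 = +-identityʳ 1#

  stirlingK : ℕ → ℕ → Carrier
  stirlingK m a = ℕ→K (stirling m a)

  stirlingK-rec : ∀ m a → stirlingK (suc m) (suc a) ≈ ℕ→K (suc a) * stirlingK m (suc a) + stirlingK m a
  stirlingK-rec m a = ≈-trans (≡⇒≈ (cong ℕ→K (stirling-rec m a)))
    (≈-trans (ℕ→K-+ (suc a ℕ.* stirling m (suc a)) (stirling m a))
             (+-congʳ (ℕ→K-* (suc a) (stirling m (suc a)))))

  -- A record, since the Π-type M ≈ₘ M' does not determine M and M' for unification.
  record _≋_ (M M' : Mono) : Set ℓ where
    constructor mk≋
    field get : M ≈ₘ M'
  open _≋_
  infix 4 _≋_

  ≋-refl : ∀ {M} → M ≋ M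
  ≋-refl = mk≋ (λ _ → ≈-refl)

  ≋-sym : ∀ {M M'} → M ≋ M' → M' ≋ M
  ≋-sym (mk≋ p) = mk≋ (λ i → ≈-sym (p i))

  ≋-trans : ∀ {M M' M''} → M ≋ M' → M' ≋ M'' → M ≋ M''
  ≋-trans (mk≋ p) (mk≋ q) = mk≋ (λ i → ≈-trans (p i) (q i))

  ≡⇒≋ : ∀ {M M'} → M ≡ M' → M ≋ M'
  ≡⇒≋ refl = ≋-refl

  expo-++ : ∀ M M' i → expo (M ++ M') i ≈ expo M i + expo M' i
  expo-++ []            M' i = ≈-sym (+-identityˡ _)
  expo-++ ((j , r) ∷ M) M' i with does (j ℤ.≟ i)
  ... | true  = ≈-trans (+-congˡ (expo-++ M M' i)) (≈-sym (+-assoc _ _ _))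
  ... | false = expo-++ M M' i

  ≋-cons : ∀ {j a b M M'} → a ≈ b → M ≋ M' → ((j , a) ∷ M) ≋ ((j , b) ∷ M')
  ≋-cons {j} {a} {b} {M} {M'} a≈b (mk≋ p) = mk≋ q
    where
    q : ((j , a) ∷ M) ≈ₘ ((j , b) ∷ M')
    q i with does (j ℤ.≟ i)
    ... | true  = +-cong a≈b (p i)
    ... | false = p i

  ≋-++ : ∀ {M₁ M₁' M₂ M₂'} → M₁ ≋ M₁' → M₂ ≋ M₂' → (M₁ ++ M₂) ≋ (M₁' ++ M₂')
  ≋-++ {M₁} {M₁'} {M₂} {M₂'} (mk≋ p) (mk≋ q) = mk≋ λ i →
    ≈-trans (expo-++ M₁ M₂ i) (≈-trans (+-cong (p i) (q i)) (≈-sym (expo-++ M₁' M₂' i)))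

  ≋-consʳ : ∀ x {M M'} → M ≋ M' → (x ∷ M) ≋ (x ∷ M')
  ≋-consʳ x = ≋-++ {M₁ = [ x ]} ≋-refl

  ≋-++-comm : ∀ M M' → (M ++ M') ≋ (M' ++ M)
  ≋-++-comm M M' = mk≋ λ i → ≈-trans (expo-++ M M' i) (≈-trans (+-comm _ _) (≈-sym (expo-++ M' M i)))

  ≋-swap : ∀ x y M → (x ∷ y ∷ M) ≋ (y ∷ x ∷ M)
  ≋-swap x y M = ≋-++ {M₁ = x ∷ y ∷ []} (≋-++-comm [ x ] [ y ]) ≋-refl

  ≋-merge : ∀ j u v M → ((j , u) ∷ (j , v) ∷ M) ≋ ((j , u + v) ∷ M)
  ≋-merge j u v M = mk≋ q
    where
    q : ((j , u) ∷ (j , v) ∷ M) ≈ₘ ((j , u + v) ∷ M)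
    q i with does (j ℤ.≟ i)
    ... | true  = ≈-sym (+-assoc _ _ _)
    ... | false = ≈-refl

  ≋-zero : ∀ j M → ((j , 0#) ∷ M) ≋ M
  ≋-zero j M = mk≋ q
    where
    q : ((j , 0#) ∷ M) ≈ₘ M
    q i with does (j ℤ.≟ i)
    ... | true  = +-identityˡ _
    ... | false = ≈-refl

  ≈ₑ-setoid : Setoid c (c ⊔ ℓ)
  ≈ₑ-setoid = record
    { _≈_           = _≈ₑ_
    ; isEquivalence = record { refl = ≈ₑ-refl ; sym = ≈ₑ-sym ; trans = ≈ₑ-trans }
    }

  infixr 5 _⟨≈⟩_
  _⟨≈⟩_ : ∀ {f g h} → f ≈ₑ g → g ≈ₑ h → f ≈ₑ h
  _⟨≈⟩_ = ≈ₑ-trans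

  ≡⇒≈ₑ : ∀ {f g} → f ≡ g → f ≈ₑ g
  ≡⇒≈ₑ refl = ≈ₑ-refl

  ∷-cong : ∀ {a b M M' f g} → a ≈ b → M ≋ M' → f ≈ₑ g → ((a , M) ∷ f) ≈ₑ ((b , M') ∷ g)
  ∷-cong a≈b M≋M' f≈g = ≈ₑ-cons a≈b (get M≋M') f≈g

  ∷-congʳ : ∀ {x f g} → f ≈ₑ g → (x ∷ f) ≈ₑ (x ∷ g)
  ∷-congʳ = ∷-cong ≈-refl ≋-refl

  map-≈ₑ : ∀ {a} {A : Set a} (f g : A → Carrier × Mono) xs →
    (∀ x → proj₁ (f x) ≈ proj₁ (g x)) → (∀ x → proj₂ (f x) ≋ proj₂ (g x)) → map f xs ≈ₑ map g xs
  map-≈ₑ f g []       p q = ≈ₑ-refl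
  map-≈ₑ f g (x ∷ xs) p q = ∷-cong (p x) (q x) (map-≈ₑ f g xs p q)

  map-≈ₑ-[] : ∀ {a} {A : Set a} (f : A → Carrier × Mono) xs → (∀ x → proj₁ (f x) ≈ 0#) → map f xs ≈ₑ []
  map-≈ₑ-[] f []       p = ≈ₑ-refl
  map-≈ₑ-[] f (x ∷ xs) p = ∷-cong (p x) ≋-refl ≈ₑ-refl ⟨≈⟩ ≈ₑ-zero ⟨≈⟩ map-≈ₑ-[] f xs p

  ++-congˡ : ∀ {f f'} g → f ≈ₑ f' → (f ++ g) ≈ₑ (f' ++ g)
  ++-congˡ g ≈ₑ-refl          = ≈ₑ-refl
  ++-congˡ g (≈ₑ-sym p)       = ≈ₑ-sym (++-congˡ g p)
  ++-congˡ g (≈ₑ-trans p q)   = ++-congˡ g p ⟨≈⟩ ++-congˡ g q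
  ++-congˡ g (≈ₑ-cons a b p)  = ≈ₑ-cons a b (++-congˡ g p)
  ++-congˡ g ≈ₑ-swap          = ≈ₑ-swap
  ++-congˡ g ≈ₑ-merge         = ≈ₑ-merge
  ++-congˡ g ≈ₑ-zero          = ≈ₑ-zero

  ++-congʳ : ∀ f {g g'} → g ≈ₑ g' → (f ++ g) ≈ₑ (f ++ g')
  ++-congʳ []      p = p
  ++-congʳ (x ∷ f) p = ∷-congʳ (++-congʳ f p)

  ++-cong : ∀ {f f' g g'} → f ≈ₑ f' → g ≈ₑ g' → (f ++ g) ≈ₑ (f' ++ g')
  ++-cong {f' = f'} {g} p q = ++-congˡ g p ⟨≈⟩ ++-congʳ f' q

  ∷-++-move : ∀ x f g → (x ∷ (f ++ g)) ≈ₑ (f ++ (x ∷ g))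
  ∷-++-move x []      g = ≈ₑ-refl
  ∷-++-move x (y ∷ f) g = ≈ₑ-swap ⟨≈⟩ ∷-congʳ (∷-++-move x f g)

  ++-comm : ∀ f g → (f ++ g) ≈ₑ (g ++ f)
  ++-comm []      g = ≡⇒≈ₑ (≡.sym (LP.++-identityʳ g))
  ++-comm (x ∷ f) g = ∷-congʳ (++-comm f g) ⟨≈⟩ ∷-++-move x g f

  ++-swapˡ : ∀ f g h → (f ++ (g ++ h)) ≈ₑ (g ++ (f ++ h))
  ++-swapˡ f g h =
    ≡⇒≈ₑ (≡.sym (LP.++-assoc f g h)) ⟨≈⟩ ++-congˡ h (++-comm f g) ⟨≈⟩ ≡⇒≈ₑ (LP.++-assoc g f h)

  ++-interchange : ∀ f g h k → ((f ++ g) ++ (h ++ k)) ≈ₑ ((f ++ h) ++ (g ++ k))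
  ++-interchange f g h k =
    ≡⇒≈ₑ (LP.++-assoc f g (h ++ k))
    ⟨≈⟩ ++-congʳ f (++-swapˡ g h k)
    ⟨≈⟩ ≡⇒≈ₑ (≡.sym (LP.++-assoc f h (g ++ k)))

  scale-cong : ∀ a {f g} → f ≈ₑ g → scale a f ≈ₑ scale a g
  scale-cong a ≈ₑ-refl          = ≈ₑ-refl
  scale-cong a (≈ₑ-sym p)       = ≈ₑ-sym (scale-cong a p)
  scale-cong a (≈ₑ-trans p q)   = scale-cong a p ⟨≈⟩ scale-cong a q
  scale-cong a (≈ₑ-cons x y p)  = ≈ₑ-cons (*-congˡ x) y (scale-cong a p)
  scale-cong a ≈ₑ-swap          = ≈ₑ-swap
  scale-cong a ≈ₑ-merge         = ≈ₑ-merge ⟨≈⟩ ∷-cong (≈-sym (distribˡ a _ _)) ≋-refl ≈ₑ-refl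
  scale-cong a ≈ₑ-zero          = ∷-cong (zeroʳ a) ≋-refl ≈ₑ-refl ⟨≈⟩ ≈ₑ-zero

  scale-congˡ : ∀ {a b} f → a ≈ b → scale a f ≈ₑ scale b f
  scale-congˡ f a≈b = map-≈ₑ _ _ f (λ _ → *-congʳ a≈b) (λ _ → ≋-refl)

  scale-++ : ∀ a f g → scale a (f ++ g) ≡ scale a f ++ scale a g
  scale-++ a f g = LP.map-++ _ f g

  scale-scale : ∀ a b f → scale a (scale b f) ≈ₑ scale (a * b) f
  scale-scale a b []      = ≈ₑ-refl
  scale-scale a b (x ∷ f) = ∷-cong (≈-sym (*-assoc a b _)) ≋-refl (scale-scale a b f)

  scale-+ : ∀ a b f → (scale a f ++ scale b f) ≈ₑ scale (a + b) f
  scale-+ a b []      = ≈ₑ-refl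
  scale-+ a b (x ∷ f) =
    ∷-congʳ (≈ₑ-sym (∷-++-move _ (scale a f) (scale b f)))
    ⟨≈⟩ ≈ₑ-merge ⟨≈⟩ ∷-cong (≈-sym (distribʳ _ a b)) ≋-refl (scale-+ a b f)

  scale-≈0 : ∀ {a} f → a ≈ 0# → scale a f ≈ₑ []
  scale-≈0 f a≈0 = map-≈ₑ-[] _ f (λ _ → ≈-trans (*-congʳ a≈0) (zeroˡ _))

  scale-≈1 : ∀ {a} f → a ≈ 1# → scale a f ≈ₑ f
  scale-≈1 []      a≈1 = ≈ₑ-refl
  scale-≈1 (x ∷ f) a≈1 = ∷-cong (≈-trans (*-congʳ a≈1) (*-identityˡ _)) ≋-refl (scale-≈1 f a≈1)

  D-++ : ∀ f g → D (f ++ g) ≡ D f ++ D g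
  D-++ []            g = refl
  D-++ ((a , M) ∷ f) g = ≡.trans (cong (scale a (Dmono M) ++_) (D-++ f g))
                                  (≡.sym (LP.++-assoc (scale a (Dmono M)) (D f) (D g)))

  D-scale : ∀ a f → D (scale a f) ≈ₑ scale a (D f)
  D-scale a []            = ≈ₑ-refl
  D-scale a ((b , M) ∷ f) =
    ++-cong (≈ₑ-sym (scale-scale a b (Dmono M))) (D-scale a f)
    ⟨≈⟩ ≡⇒≈ₑ (≡.sym (scale-++ a (scale b (Dmono M)) (D f)))

  -- d/dx ℓᵢʳ = r · ℓᵢʳ · logDerivative i
  logDerivative : ℤ → Mono
  logDerivative i = dpart i 0#

  ≋-split : ∀ j r M → ((j , r - 1#) ∷ M) ≋ ((j , r) ∷ (j , 0# - 1#) ∷ M)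
  ≋-split j r M = ≋-trans (≋-cons (+-congˡ (≈-sym (+-identityˡ _))) ≋-refl) (≋-sym (≋-merge j r _ M))

  dpart-≋ : ∀ i r → dpart i r ≋ ((i , r) ∷ logDerivative i)
  dpart-≋ (+ zero)  r = ≋-split _ r _
  dpart-≋ (+ suc n) r = ≋-split _ r _
  dpart-≋ -[1+ n ]  r = ≋-split _ r _

  DmonoAfter : Mono → Mono → Elem
  DmonoAfter P M = map (λ (a , M') → (a , P ++ M')) (Dmono M)

  DmonoAfter-∷ : ∀ P i r M →
    DmonoAfter P ((i , r) ∷ M) ≡ ((r , P ++ (dpart i r ++ M)) ∷ DmonoAfter (P ++ [ (i , r) ]) M)
  DmonoAfter-∷ P i r M = cong ((r , P ++ (dpart i r ++ M)) ∷_)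
    (≡.trans (≡.sym (LP.map-∘ (Dmono M)))
      (LP.map-cong (λ (a , M') → cong (a ,_) (≡.sym (LP.++-assoc P [ (i , r) ] M'))) (Dmono M)))

  DmonoCanonical : List ℤ → Mono → Mono → Elem
  DmonoCanonical I P M = map (λ k → (expo M k , P ++ M ++ logDerivative k)) I

  extract-absent : ∀ i r (e : ℤ → Carrier) (Q : ℤ → Mono) I → All (λ k → ¬ i ≡ k) I →
    map (λ k → ((if does (i ℤ.≟ k) then r + e k else e k) , Q k)) I ≈ₑ map (λ k → (e k , Q k)) I
  extract-absent i r e Q []      []          = ≈ₑ-refl
  extract-absent i r e Q (k ∷ I) (i≢k ∷ i∉I) rewrite dec-false (i ℤ.≟ k) i≢k =
    ∷-congʳ (extract-absent i r e Q I i∉I)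

  extract : ∀ i r (e : ℤ → Carrier) (Q : ℤ → Mono) I → Unique I → i ∈ I →
    map (λ k → ((if does (i ℤ.≟ k) then r + e k else e k) , Q k)) I ≈ₑ ((r , Q i) ∷ map (λ k → (e k , Q k)) I)
  extract i r e Q (k ∷ I) (k∉I ∷ _) (here refl) rewrite dec-true (i ℤ.≟ i) refl =
    ∷-congʳ (extract-absent i r e Q I k∉I) ⟨≈⟩ ≈ₑ-sym ≈ₑ-merge
  extract i r e Q (k ∷ I) (k∉I ∷ I!) (there i∈I)
    rewrite dec-false (i ℤ.≟ k) (λ i≡k → All.lookup k∉I i∈I (≡.sym i≡k)) =
    ∷-congʳ (extract i r e Q I I! i∈I) ⟨≈⟩ ≈ₑ-swap

  -- Leibniz rule in a form that depends only on the exponents of M: for a duplicate-free I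
  -- containing all indices of M, P · D M = Σ_{k ∈ I} (exponent of ℓₖ in M) · P · M · ℓₖ'/ℓₖ.
  DmonoAfter≈canonical : ∀ I → Unique I → ∀ M → All ((_∈ I) ∘ proj₁) M → ∀ P →
    DmonoAfter P M ≈ₑ DmonoCanonical I P M
  DmonoAfter≈canonical I I! [] _ P = ≈ₑ-sym (map-≈ₑ-[] _ I (λ _ → ≈-refl))
  DmonoAfter≈canonical I I! ((i , r) ∷ M) (i∈I ∷ M⊆I) P =
    ≡⇒≈ₑ (DmonoAfter-∷ P i r M)
    ⟨≈⟩ ∷-congʳ (DmonoAfter≈canonical I I! M M⊆I (P ++ [ (i , r) ]))
    ⟨≈⟩ ∷-cong ≈-refl (≋-++ {M₁ = P} ≋-refl head)
          (map-≈ₑ _ (λ k → (expo M k , P ++ (i , r) ∷ M ++ logDerivative k)) I (λ _ → ≈-refl)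
            (λ k → ≡⇒≋ (LP.++-assoc P [ (i , r) ] (M ++ logDerivative k))))
    ⟨≈⟩ ≈ₑ-sym (extract i r (expo M) (λ k → P ++ (i , r) ∷ M ++ logDerivative k) I I! i∈I)
    where
    head : (dpart i r ++ M) ≋ ((i , r) ∷ M ++ logDerivative i)
    head = ≋-trans (≋-++ (dpart-≋ i r) ≋-refl) (≋-cons ≈-refl (≋-++-comm (logDerivative i) M))

  indices⊆ : ∀ (M : Mono) I → (∀ {i} → i ∈ map proj₁ M → i ∈ I) → All ((_∈ I) ∘ proj₁) M
  indices⊆ M I ⊆I = AllP.map⁻ (All.tabulate ⊆I)

  Dmono-cong : ∀ {M M'} → M ≋ M' → Dmono M ≈ₑ Dmono M'
  Dmono-cong {M} {M'} (mk≋ p) =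
    ≡⇒≈ₑ (≡.sym (LP.map-id (Dmono M)))
    ⟨≈⟩ DmonoAfter≈canonical I I! M (indices⊆ M I (∈-I ∘ ∈P.∈-++⁺ˡ)) []
    ⟨≈⟩ map-≈ₑ _ _ I p (λ k → ≋-++ {M₁ = M} (mk≋ p) ≋-refl)
    ⟨≈⟩ ≈ₑ-sym (DmonoAfter≈canonical I I! M' (indices⊆ M' I (∈-I ∘ ∈P.∈-++⁺ʳ (map proj₁ M))) [])
    ⟨≈⟩ ≡⇒≈ₑ (LP.map-id (Dmono M'))
    where
    I = L.deduplicate ℤ._≟_ (map proj₁ M ++ map proj₁ M')
    I! = UniqueP.deduplicate-! ℤ._≟_ (map proj₁ M ++ map proj₁ M')
    ∈-I : ∀ {i} → i ∈ map proj₁ M ++ map proj₁ M' → i ∈ I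
    ∈-I = ∈P.∈-deduplicate⁺ ℤ._≟_

  D-cong : ∀ {f g} → f ≈ₑ g → D f ≈ₑ D g
  D-cong ≈ₑ-refl              = ≈ₑ-refl
  D-cong (≈ₑ-sym p)           = ≈ₑ-sym (D-cong p)
  D-cong (≈ₑ-trans p q)       = D-cong p ⟨≈⟩ D-cong q
  D-cong (≈ₑ-cons {a} {b} {M' = M'} a≈b M≈M' p) =
    ++-cong (scale-cong a (Dmono-cong (mk≋ M≈M')) ⟨≈⟩ scale-congˡ (Dmono M') a≈b) (D-cong p)
  D-cong {(a , M) ∷ (b , M') ∷ f} ≈ₑ-swap = ++-swapˡ (scale a (Dmono M)) (scale b (Dmono M')) (D f)
  D-cong {(a , M) ∷ (b , M) ∷ f} ≈ₑ-merge =
    ≡⇒≈ₑ (≡.sym (LP.++-assoc (scale a (Dmono M)) (scale b (Dmono M)) (D f)))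
    ⟨≈⟩ ++-congˡ (D f) (scale-+ a b (Dmono M))
  D-cong {(a , M) ∷ f} ≈ₑ-zero = ++-congˡ (D f) (scale-≈0 (Dmono M) ≈-refl)

  prefix : ℤ × Carrier → Elem → Elem
  prefix x = map (λ (a , M) → (a , x ∷ M))

  prefix-cong : ∀ x {f g} → f ≈ₑ g → prefix x f ≈ₑ prefix x g
  prefix-cong x ≈ₑ-refl           = ≈ₑ-refl
  prefix-cong x (≈ₑ-sym p)        = ≈ₑ-sym (prefix-cong x p)
  prefix-cong x (≈ₑ-trans p q)    = prefix-cong x p ⟨≈⟩ prefix-cong x q
  prefix-cong x (≈ₑ-cons a≈b M≈M' p) = ∷-cong a≈b (≋-consʳ x (mk≋ M≈M')) (prefix-cong x p)
  prefix-cong x ≈ₑ-swap           = ≈ₑ-swap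
  prefix-cong x ≈ₑ-merge          = ≈ₑ-merge
  prefix-cong x ≈ₑ-zero           = ≈ₑ-zero

  prefix-scale-++ : ∀ x a f g → prefix x (scale a f ++ g) ≡ scale a (prefix x f) ++ prefix x g
  prefix-scale-++ x a []      g = refl
  prefix-scale-++ x a (_ ∷ f) g = cong (_ ∷_) (prefix-scale-++ x a f g)

  prefix-merge : ∀ j u v f → prefix (j , u) (prefix (j , v) f) ≈ₑ prefix (j , v + u) f
  prefix-merge j u v []            = ≈ₑ-refl
  prefix-merge j u v ((_ , M) ∷ f) =
    ∷-cong ≈-refl (≋-trans (≋-merge j u v M) (≋-cons (+-comm u v) ≋-refl)) (prefix-merge j u v f)

  prefix-zero : ∀ j f → prefix (j , 0#) f ≈ₑ f
  prefix-zero j []            = ≈ₑ-refl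
  prefix-zero j ((_ , M) ∷ f) = ∷-cong ≈-refl (≋-zero j M) (prefix-zero j f)

  Dmono-∷ : ∀ i r M → Dmono ((i , r) ∷ M) ≡ ((r , dpart i r ++ M) ∷ prefix (i , r) (Dmono M))
  Dmono-∷ i r M = cong ((r , dpart i r ++ M) ∷_) (LP.map-cong (λ _ → refl) (Dmono M))

  -- The shift ℓ₋ᵢ ↦ ℓ₋₍ᵢ₊₁₎

  shiftIndex : ℤ → ℤ
  shiftIndex (+ n)    = + n
  shiftIndex -[1+ n ] = -[1+ suc n ]

  shiftIndex-injective : ∀ {i j} → shiftIndex i ≡ shiftIndex j → i ≡ j
  shiftIndex-injective {+ n}      {+ .n}      refl = refl
  shiftIndex-injective { -[1+ n ]} { -[1+ .n ]} refl = refl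

  shiftIndex≢-1 : ∀ j → ¬ shiftIndex j ≡ -[1+ 0 ]
  shiftIndex≢-1 (+ n)    ()
  shiftIndex≢-1 -[1+ n ] ()

  shiftFactor : ℤ × Carrier → ℤ × Carrier
  shiftFactor (i , r) = (shiftIndex i , r)

  shiftMono : Mono → Mono
  shiftMono = map shiftFactor

  shift : Elem → Elem
  shift = map (λ (a , M) → (a , shiftMono M))

  expo-shiftMono : ∀ M i → expo (shiftMono M) (shiftIndex i) ≈ expo M i
  expo-shiftMono []            i = ≈-refl
  expo-shiftMono ((j , r) ∷ M) i with j ℤ.≟ i | shiftIndex j ℤ.≟ shiftIndex i
  ... | yes _   | yes _   = +-congˡ (expo-shiftMono M i)
  ... | no _    | no _    = expo-shiftMono M i
  ... | yes j≡i | no σj≢σi = ⊥-elim (σj≢σi (cong shiftIndex j≡i))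
  ... | no j≢i  | yes σj≡σi = ⊥-elim (j≢i (shiftIndex-injective σj≡σi))

  expo-shiftMono-1 : ∀ M → expo (shiftMono M) -[1+ 0 ] ≈ 0#
  expo-shiftMono-1 []            = ≈-refl
  expo-shiftMono-1 ((j , r) ∷ M) rewrite dec-false (shiftIndex j ℤ.≟ -[1+ 0 ]) (shiftIndex≢-1 j) =
    expo-shiftMono-1 M

  shiftMono-cong : ∀ {M M'} → M ≋ M' → shiftMono M ≋ shiftMono M'
  shiftMono-cong {M} {M'} (mk≋ p) = mk≋ q
    where
    q : ∀ k → expo (shiftMono M) k ≈ expo (shiftMono M') k
    q (+ n)        = ≈-trans (expo-shiftMono M (+ n))
                             (≈-trans (p (+ n)) (≈-sym (expo-shiftMono M' (+ n))))
    q -[1+ zero ]  = ≈-trans (expo-shiftMono-1 M) (≈-sym (expo-shiftMono-1 M'))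
    q -[1+ suc n ] = ≈-trans (expo-shiftMono M -[1+ n ])
                             (≈-trans (p -[1+ n ]) (≈-sym (expo-shiftMono M' -[1+ n ])))

  shift-cong : ∀ {f g} → f ≈ₑ g → shift f ≈ₑ shift g
  shift-cong ≈ₑ-refl           = ≈ₑ-refl
  shift-cong (≈ₑ-sym p)        = ≈ₑ-sym (shift-cong p)
  shift-cong (≈ₑ-trans p q)    = shift-cong p ⟨≈⟩ shift-cong q
  shift-cong (≈ₑ-cons a≈b M≈M' p) = ∷-cong a≈b (shiftMono-cong (mk≋ M≈M')) (shift-cong p)
  shift-cong ≈ₑ-swap           = ≈ₑ-swap
  shift-cong ≈ₑ-merge          = ≈ₑ-merge
  shift-cong ≈ₑ-zero           = ≈ₑ-zero

  shift-scale-++ : ∀ a f g → shift (scale a f ++ g) ≡ scale a (shift f) ++ shift g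
  shift-scale-++ a []      g = refl
  shift-scale-++ a (_ ∷ f) g = cong (_ ∷_) (shift-scale-++ a f g)

  Negative : ℤ → Set
  Negative (+ _)    = ⊥
  Negative -[1+ _ ] = ⊤

  NegativeMono : Mono → Set c
  NegativeMono = All (Negative ∘ proj₁)

  NegativeElem : Elem → Set c
  NegativeElem = All (NegativeMono ∘ proj₂)

  prefix-negative : ∀ x f → Negative (proj₁ x) → NegativeElem f → NegativeElem (prefix x f)
  prefix-negative x []      _   []               = []
  prefix-negative x (_ ∷ f) x<0 (M<0 ∷ f<0) = (x<0 ∷ M<0) ∷ prefix-negative x f x<0 f<0

  scale-negative : ∀ a f → NegativeElem f → NegativeElem (scale a f)
  scale-negative a []      []          = []
  scale-negative a (_ ∷ f) (M<0 ∷ f<0) = M<0 ∷ scale-negative a f f<0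

  dpart-negative : ∀ n r → NegativeMono (dpart -[1+ n ] r)
  dpart-negative n r = tt ∷ AllP.map⁺ (All.universal (λ _ → tt) (upTo (suc n)))

  Dmono-negative : ∀ M → NegativeMono M → NegativeElem (Dmono M)
  Dmono-negative []                  []           = []
  Dmono-negative ((-[1+ n ] , r) ∷ M) (_ ∷ M<0) rewrite Dmono-∷ -[1+ n ] r M =
    AllP.++⁺ (dpart-negative n r) M<0 ∷ prefix-negative _ (Dmono M) tt (Dmono-negative M M<0)

  D-negative : ∀ f → NegativeElem f → NegativeElem (D f)
  D-negative []            []          = []
  D-negative ((a , M) ∷ f) (M<0 ∷ f<0) =
    AllP.++⁺ (scale-negative a (Dmono M) (Dmono-negative M M<0)) (D-negative f f<0)

  Diter-negative : ∀ k f → NegativeElem f → NegativeElem (Diter k f)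
  Diter-negative zero    f f<0 = f<0
  Diter-negative (suc k) f f<0 = D-negative (Diter k f) (Diter-negative k f f<0)

  ℓ₋₁^ : Carrier → ℤ × Carrier
  ℓ₋₁^ c = (-[1+ 0 ] , c)

  prefix-shift-comm : ∀ x f →
    prefix (shiftFactor x) (prefix (ℓ₋₁^ 1#) (shift f)) ≈ₑ prefix (ℓ₋₁^ 1#) (shift (prefix x f))
  prefix-shift-comm x []            = ≈ₑ-refl
  prefix-shift-comm x ((_ , M) ∷ f) =
    ∷-cong ≈-refl (≋-swap (shiftFactor x) (ℓ₋₁^ 1#) (shiftMono M)) (prefix-shift-comm x f)

  dpart-shift : ∀ n r →
    dpart -[1+ suc n ] r ≡ ((-[1+ suc n ] , r - 1#) ∷ ℓ₋₁^ 1# ∷ shiftMono (L.drop 1 (dpart -[1+ n ] r)))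
  dpart-shift n r = cong (λ M → (-[1+ suc n ] , r - 1#) ∷ ℓ₋₁^ 1# ∷ M)
    (≡.trans (LP.map-applyUpTo suc _ (suc n))
      (≡.sym (≡.trans (≡.sym (LP.map-∘ (upTo (suc n)))) (LP.map-upTo _ (suc n)))))

  -- The chain rule for x ↦ eˣ.
  Dmono-shift : ∀ M → NegativeMono M → Dmono (shiftMono M) ≈ₑ prefix (ℓ₋₁^ 1#) (shift (Dmono M))
  Dmono-shift []                   []        = ≈ₑ-refl
  Dmono-shift ((-[1+ n ] , r) ∷ M) (_ ∷ M<0)
    rewrite Dmono-∷ -[1+ suc n ] r (shiftMono M) | Dmono-∷ -[1+ n ] r M =
    ∷-cong ≈-refl head
      (prefix-cong (-[1+ suc n ] , r) (Dmono-shift M M<0) ⟨≈⟩ prefix-shift-comm (-[1+ n ] , r) (Dmono M))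
    where
    head : (dpart -[1+ suc n ] r ++ shiftMono M) ≋ (ℓ₋₁^ 1# ∷ shiftMono (dpart -[1+ n ] r ++ M))
    head = ≋-trans (≡⇒≋ (cong (_++ shiftMono M) (dpart-shift n r)))
             (≋-trans (≋-swap (-[1+ suc n ] , r - 1#) (ℓ₋₁^ 1#) _)
               (≡⇒≋ (cong (ℓ₋₁^ 1# ∷_) (≡.sym (LP.map-++ shiftFactor (dpart -[1+ n ] r) M)))))

  D-shift : ∀ f → NegativeElem f → D (shift f) ≈ₑ prefix (ℓ₋₁^ 1#) (shift (D f))
  D-shift []            []          = ≈ₑ-refl
  D-shift ((a , M) ∷ f) (M<0 ∷ f<0) =
    ++-cong (scale-cong a (Dmono-shift M M<0)) (D-shift f f<0)
    ⟨≈⟩ ≡⇒≈ₑ (≡.sym (≡.trans (cong (prefix (ℓ₋₁^ 1#)) (shift-scale-++ a (Dmono M) (D f)))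
                             (prefix-scale-++ (ℓ₋₁^ 1#) a (shift (Dmono M)) (shift (D f)))))

  minus-1-plus-1 : ∀ x → (x - 1#) + 1# ≈ x
  minus-1-plus-1 x = ≈-trans (+-assoc _ _ _) (≈-trans (+-congˡ (-‿inverseˡ 1#)) (+-identityʳ x))

  D-prefix-ℓ₋₁^ : ∀ c f →
    D (prefix (ℓ₋₁^ c) f) ≈ₑ (scale c (prefix (ℓ₋₁^ c) f) ++ prefix (ℓ₋₁^ c) (D f))
  D-prefix-ℓ₋₁^ c []            = ≈ₑ-refl
  D-prefix-ℓ₋₁^ c ((b , M) ∷ f) =
    ≡⇒≈ₑ (cong (λ g → scale b g ++ D (prefix x f)) (Dmono-∷ -[1+ 0 ] c M))
    ⟨≈⟩ ∷-cong (*-comm b c) (≋-trans (≋-merge _ _ _ M) (≋-cons (minus-1-plus-1 c) ≋-refl))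
          (++-congʳ (scale b (prefix x (Dmono M))) (D-prefix-ℓ₋₁^ c f)
           ⟨≈⟩ ++-swapˡ (scale b (prefix x (Dmono M))) (scale c (prefix x f)) (prefix x (D f))
           ⟨≈⟩ ++-congʳ (scale c (prefix x f))
                 (≡⇒≈ₑ (≡.sym (prefix-scale-++ x b (Dmono M) (D f)))))
    where x = ℓ₋₁^ c

  sumUpTo : ℕ → (ℕ → Elem) → Elem
  sumUpTo n g = concat (applyUpTo g n)

  sumUpTo-suc : ∀ n g → sumUpTo (suc n) g ≡ sumUpTo n g ++ g n
  sumUpTo-suc zero    g = LP.++-identityʳ (g 0)
  sumUpTo-suc (suc n) g = ≡.trans (cong (g 0 ++_) (sumUpTo-suc n (g ∘ suc)))
                                   (≡.sym (LP.++-assoc (g 0) (sumUpTo n (g ∘ suc)) (g (suc n))))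

  sumUpTo-cong : ∀ n {g h} → (∀ j → j < n → g j ≈ₑ h j) → sumUpTo n g ≈ₑ sumUpTo n h
  sumUpTo-cong zero    p = ≈ₑ-refl
  sumUpTo-cong (suc n) p = ++-cong (p 0 (s≤s z≤n)) (sumUpTo-cong n (λ j j<n → p (suc j) (s≤s j<n)))

  sumUpTo-++ : ∀ n g h → sumUpTo n (λ a → g a ++ h a) ≈ₑ (sumUpTo n g ++ sumUpTo n h)
  sumUpTo-++ zero    g h = ≈ₑ-refl
  sumUpTo-++ (suc n) g h = ++-congʳ (g 0 ++ h 0) (sumUpTo-++ n (g ∘ suc) (h ∘ suc))
    ⟨≈⟩ ++-interchange (g 0) (h 0) (sumUpTo n (g ∘ suc)) (sumUpTo n (h ∘ suc))

  sumUpTo-reverse : ∀ n g → sumUpTo n g ≈ₑ sumUpTo n (λ j → g (n ∸ suc j))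
  sumUpTo-reverse zero    g = ≈ₑ-refl
  sumUpTo-reverse (suc n) g =
    ++-congʳ (g 0) (sumUpTo-reverse n (g ∘ suc))
    ⟨≈⟩ ++-comm (g 0) _
    ⟨≈⟩ ++-cong (sumUpTo-cong n (λ j j<n → ≡⇒≈ₑ (cong g (≡.sym (ℕP.+-∸-assoc 1 j<n)))))
                (≡⇒≈ₑ (cong g (≡.sym (ℕP.n∸n≡0 n))))
    ⟨≈⟩ ≡⇒≈ₑ (≡.sym (sumUpTo-suc n (λ j → g (n ∸ j))))

  D-sumUpTo : ∀ n g → D (sumUpTo n g) ≡ sumUpTo n (D ∘ g)
  D-sumUpTo zero    g = refl
  D-sumUpTo (suc n) g = ≡.trans (D-++ (g 0) (sumUpTo n (g ∘ suc)))
                                 (cong (D (g 0) ++_) (D-sumUpTo n (g ∘ suc)))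

  map-concatMap-upTo : ∀ {A : Set} (f : A → Carrier × Mono) (h : ℕ → List A) n →
    map f (concatMap h (upTo n)) ≡ sumUpTo n (map f ∘ h)
  map-concatMap-upTo f h n =
    ≡.trans (≡.sym (LP.concat-map (map h (upTo n))))
      (cong concat (≡.trans (≡.sym (LP.map-∘ (upTo n))) (LP.map-upTo _ n)))

  -- Iterated derivatives

  touchardTerm : Elem → ℕ → Elem
  touchardTerm F a = prefix (ℓ₋₁^ (ℕ→K a)) (shift (Diter a F))

  D-touchardTerm : ∀ F → NegativeElem F → ∀ a →
    D (touchardTerm F a) ≈ₑ (scale (ℕ→K a) (touchardTerm F a) ++ touchardTerm F (suc a))
  D-touchardTerm F F<0 a =
    D-prefix-ℓ₋₁^ (ℕ→K a) (shift (Diter a F))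
    ⟨≈⟩ ++-congʳ (scale (ℕ→K a) (touchardTerm F a))
          (prefix-cong (ℓ₋₁^ (ℕ→K a)) (D-shift (Diter a F) (Diter-negative a F F<0))
           ⟨≈⟩ prefix-merge -[1+ 0 ] (ℕ→K a) 1# (shift (Diter (suc a) F)))

  Diter-shift : ∀ F → NegativeElem F → ∀ m →
    Diter m (shift F) ≈ₑ sumUpTo (suc m) (λ a → scale (stirlingK m a) (touchardTerm F a))
  Diter-shift F F<0 zero =
    ≈ₑ-sym (≡⇒≈ₑ (LP.++-identityʳ _) ⟨≈⟩ scale-≈1 _ ℕ→K-1 ⟨≈⟩ prefix-zero -[1+ 0 ] (shift F))
  Diter-shift F F<0 (suc m) = begin
    D (Diter m (shift F))
      ≈⟨ D-cong (Diter-shift F F<0 m) ⟩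
    D (sumUpTo (suc m) (terms m))
      ≡⟨ D-sumUpTo (suc m) (terms m) ⟩
    sumUpTo (suc m) (D ∘ terms m)
      ≈⟨ sumUpTo-cong (suc m) {D ∘ terms m} (λ a _ → D-terms a) ⟩
    sumUpTo (suc m) (λ a → lower a ++ upper a)
      ≈⟨ sumUpTo-++ (suc m) lower upper ⟩
    sumUpTo (suc m) lower ++ sumUpTo (suc m) upper
      ≈⟨ ++-congˡ (sumUpTo (suc m) upper) reindex ⟩
    sumUpTo (suc m) lower' ++ sumUpTo (suc m) upper
      ≈⟨ sumUpTo-++ (suc m) lower' upper ⟨
    sumUpTo (suc m) (λ a → lower' a ++ upper a)
      ≈⟨ sumUpTo-cong (suc m) {h = terms (suc m) ∘ suc} (λ a _ → recurrence a) ⟩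
    sumUpTo (suc m) (terms (suc m) ∘ suc)
      ≈⟨ ++-congˡ (sumUpTo (suc m) (terms (suc m) ∘ suc)) (scale-≈0 (T 0) ≈-refl) ⟨
    sumUpTo (suc (suc m)) (terms (suc m))
      ∎
    where
    open SetoidReasoning ≈ₑ-setoid
    S = stirlingK
    T = touchardTerm F
    terms : ℕ → ℕ → Elem
    terms k a = scale (S k a) (T a)
    lower upper lower' : ℕ → Elem
    lower a  = scale (S m a) (scale (ℕ→K a) (T a))
    upper a  = scale (S m a) (T (suc a))
    lower' a = scale (ℕ→K (suc a) * S m (suc a)) (T (suc a))

    D-terms : ∀ a → D (terms m a) ≈ₑ (lower a ++ upper a)
    D-terms a = D-scale _ (T a) ⟨≈⟩ scale-cong _ (D-touchardTerm F F<0 a)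
      ⟨≈⟩ ≡⇒≈ₑ (scale-++ _ (scale (ℕ→K a) (T a)) (T (suc a)))

    -- the a = 0 term vanishes, and a new top term appears since S(m, m+1) = 0
    reindex : sumUpTo (suc m) lower ≈ₑ sumUpTo (suc m) lower'
    reindex =
      ++-congˡ (sumUpTo m (lower ∘ suc)) (scale-cong (S m 0) (scale-≈0 (T 0) ≈-refl))
      ⟨≈⟩ sumUpTo-cong m {lower ∘ suc} {lower'}
            (λ a _ → scale-scale (S m (suc a)) (ℕ→K (suc a)) (T (suc a))
                     ⟨≈⟩ scale-congˡ (T (suc a)) (*-comm (S m (suc a)) (ℕ→K (suc a))))
      ⟨≈⟩ ≡⇒≈ₑ (≡.sym (LP.++-identityʳ _))
      ⟨≈⟩ ++-congʳ (sumUpTo m lower') (≈ₑ-sym (scale-≈0 (T (suc m))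
            (≈-trans (*-congˡ (≡⇒≈ (cong ℕ→K (stirling-vanish {m} (ℕP.n<1+n m))))) (zeroʳ _))))
      ⟨≈⟩ ≡⇒≈ₑ (≡.sym (sumUpTo-suc m lower'))

    recurrence : ∀ a → (lower' a ++ upper a) ≈ₑ terms (suc m) (suc a)
    recurrence a = scale-+ _ _ (T (suc a)) ⟨≈⟩ scale-congˡ (T (suc a)) (≈-sym (stirlingK-rec m a))

  module _ (inv : ℕ → Carrier) where
    open Exp inv

    Diter-ℓ₋₁ : ∀ m r → Diter m (ellNeg 1 r) ≈ₑ [ (pow r m , [ (-[1+ 0 ] , r) ]) ]
    Diter-ℓ₋₁ zero    r = ≈ₑ-refl
    Diter-ℓ₋₁ (suc m) r = D-cong (Diter-ℓ₋₁ m r)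
      ⟨≈⟩ ∷-cong (*-comm _ _) (≋-trans (≋-merge _ _ _ []) (≋-cons (minus-1-plus-1 r) ≋-refl)) ≈ₑ-refl

    -- Prepending j₁ shifts α: α (j ∷ js) (i + 2) = α js (i + 1) holds definitionally.
    exponentFactor : List ℕ → ℕ → ℤ × Carrier
    exponentFactor js i = (ℤ.- (+ i) , ℕ→K (α js (suc i)))

    stirlingFactor : List ℕ → ℕ → ℕ
    stirlingFactor js i = stirling (α js i) (α js (suc i))

    term-mono-∷ : ∀ n r j js → (ℓ₋₁^ (ℕ→K (NL.sum js)) ∷ shiftMono (proj₂ (term (suc n) r js)))
                               ≋ proj₂ (term (suc (suc n)) r (j ∷ js))
    term-mono-∷ n r j js =
      ≋-trans (≋-swap (ℓ₋₁^ (ℕ→K (NL.sum js))) (-[1+ suc n ] , r) _)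
        (≋-consʳ (-[1+ suc n ] , r) (≋-consʳ _ (≡⇒≋ (≡.sym shifted))))
      where
      shifted : map (exponentFactor (j ∷ js)) (map suc (applyUpTo suc n))
              ≡ shiftMono (map (exponentFactor js) (map suc (upTo n)))
      shifted = ≡.trans (map-suc-applyUpTo-suc (exponentFactor (j ∷ js)) n)
        (≡.sym (≡.trans (cong shiftMono (map-suc-upTo (exponentFactor js) n))
                        (LP.map-applyUpTo _ shiftFactor n)))

    term-coeff-∷ : ∀ n r j js → stirlingK (j ℕ.+ NL.sum js) (NL.sum js) * proj₁ (term (suc n) r js)
                               ≈ proj₁ (term (suc (suc n)) r (j ∷ js))
    term-coeff-∷ n r j js =
      ≈-trans (≈-sym (*-assoc _ _ _)) (≈-trans (*-congʳ (*-comm _ _)) (≈-trans (*-assoc _ _ _)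
        (*-congˡ (≈-sym (≈-trans (ℕ→K-* (stirling (j ℕ.+ NL.sum js) (NL.sum js)) _)
          (*-congˡ (≡⇒≈ (cong (ℕ→K ∘ NL.product) shifted))))))))
      where
      shifted : map (stirlingFactor (j ∷ js)) (map suc (applyUpTo suc n))
              ≡ map (stirlingFactor js) (map suc (upTo n))
      shifted = ≡.trans (map-suc-applyUpTo-suc (stirlingFactor (j ∷ js)) n)
                        (≡.sym (map-suc-upTo (stirlingFactor js) n))

    term-∷ : ∀ n r j a m → j ℕ.+ a ≡ m → ∀ X → All (λ js → NL.sum js ≡ a) X →
      scale (stirlingK m a) (prefix (ℓ₋₁^ (ℕ→K a)) (shift (map (term (suc n) r) X)))
        ≈ₑ map (term (suc (suc n)) r) (map (j ∷_) X)
    term-∷ n r j a m _    []       []              = ≈ₑ-refl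
    term-∷ n r j a m refl   (js ∷ X) (refl ∷ X-sums) =
      ∷-cong (term-coeff-∷ n r j js) (term-mono-∷ n r j js) (term-∷ n r j a m refl X X-sums)

    Diter-ellNeg : ∀ n m r → Diter m (ellNeg (suc n) r) ≈ₑ map (term (suc n) r) (compositions (suc n) m)
    Diter-ellNeg zero m r =
      Diter-ℓ₋₁ m r
      ⟨≈⟩ ∷-cong (≈-sym coeff) ≋-refl ≈ₑ-refl
      ⟨≈⟩ ≡⇒≈ₑ (cong (map (term 1 r)) (≡.sym (compositions-1 m)))
      where
      coeff : pow r (m ℕ.+ 0) * ℕ→K 1 ≈ pow r m
      coeff = ≈-trans (*-congˡ ℕ→K-1) (≈-trans (*-identityʳ _) (≡⇒≈ (cong (pow r) (ℕP.+-identityʳ m))))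
    Diter-ellNeg (suc n) m r = begin
      Diter m (shift F)
        ≈⟨ Diter-shift F F<0 m ⟩
      sumUpTo (suc m) (λ a → scale (stirlingK m a) (touchardTerm F a))
        ≈⟨ sumUpTo-cong (suc m) {h = G} (λ a _ → scale-cong _ (prefix-cong _ (shift-cong (Diter-ellNeg n a r))))
         ⟩
      sumUpTo (suc m) G
        ≈⟨ sumUpTo-reverse (suc m) G ⟩
      sumUpTo (suc m) (λ j → G (m ∸ j))
        ≈⟨ sumUpTo-cong (suc m) {g = G ∘ (m ∸_)} (λ j j≤m → term-∷ n r j (m ∸ j) m (ℕP.m+[n∸m]≡n (ℕP.≤-pred j≤m))
                                   (compositions (suc n) (m ∸ j)) (compositions-sum (suc n) (m ∸ j)))
         ⟩
      sumUpTo (suc m) (λ j → map (term (suc (suc n)) r) (map (j ∷_) (compositions (suc n) (m ∸ j))))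
        ≡⟨ map-concatMap-upTo (term (suc (suc n)) r) (λ j → map (j ∷_) (compositions (suc n) (m ∸ j))) (suc m)
         ⟨
      map (term (suc (suc n)) r) (compositions (suc (suc n)) m) ∎
      where
      open SetoidReasoning ≈ₑ-setoid
      -- ellNeg (n + 2) r is shift F by definition
      F = ellNeg (suc n) r
      F<0 : NegativeElem F
      F<0 = (tt ∷ []) ∷ []
      G : ℕ → Elem
      G a = scale (stirlingK m a)
                  (prefix (ℓ₋₁^ (ℕ→K a)) (shift (map (term (suc n) r) (compositions (suc n) a))))

mainTheorem3 : ∀ {c ℓ} (K : CommutativeRing c ℓ) (inv : ℕ → CommutativeRing.Carrier K) →
    (∀ n → CommutativeRing._≈_ K (CommutativeRing._*_ K (Alg.ℕ→K K (suc n)) (inv n)) (CommutativeRing.1# K)) →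
    (N : ℕ) → 1 ≤ N → (r : CommutativeRing.Carrier K) →
    Alg._≈ₚ_ K (Alg.Exp.expYD K inv (Alg.Exp.ellNeg K inv N r)) (Alg.Exp.rhs K inv N r)
mainTheorem3 K inv _ (suc n) _ r m =
  scale-cong K (Alg.Exp.invFact K inv m) (Diter-ellNeg K inv n m r)
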